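{- Let $k\ge 3$ and let $G$ be a $k$-connected equimatchable factor-critical graph with a vertex cut $S$ of size $k$. Assume that $G-S$ has precisely two components $C$ and $D$, both of them complete graphs. Then for each vertex $s\in S$ there is a matching $M$ consisting only of edges with both endpoints in $S\setminus\{s\}$ such that $|S\setminus V(M)|=2$ if $k$ is even and $|S\setminus V(M)|=3$ if $k$ is odd.
   Context: All graphs are finite, simple and undirected. A graph is equimatchable if every maximal matching is a maximum matching. A graph is factor-critical if $G-v$ has a perfect matching for every vertex $v$. $V(M)$ denotes the set of vertices covered by the matching $M$. -}

module Defs where

open import Data.Nat using (ℕ; suc; _<_; _≤_)
open import Data.Bool using (Bool; true; false)
open import Data.Fin using (Fin)
open import Data.Fin.Properties using (_≟_)
open import Data.Fin.Subset using (Subset; _∈_; _∉_; ∣_∣)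
open import Data.Product using (_×_; _,_; Σ; ∃)
open import Data.List using (List; []; _∷_; concatMap; length)
open import Data.List.Relation.Unary.All using (All)
open import Data.List.Relation.Unary.Unique.Propositional using (Unique)
import Data.List.Membership.Propositional as Mem
import Data.List.Membership.DecPropositional as DecMem
open import Data.Empty using (⊥)
open import Data.Vec using (tabulate)
open import Relation.Nullary using (¬_; does)
open import Relation.Binary.PropositionalEquality using (_≡_; _≢_)

record Graph (n : ℕ) : Set where
  field
    adj   : Fin n → Fin n → Bool
    sym   : ∀ u v → adj u v ≡ adj v u
    irrefl : ∀ v → adj v v ≡ false

module _ {n : ℕ} (G : Graph n) where
  open Graph G
  open DecMem (_≟_ {n}) using () renaming (_∈?_ to _∈L?_)

  Edge : Fin n → Fin n → Set
  Edge u v = adj u v ≡ true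

  data Reach (P : Fin n → Set) : Fin n → Fin n → Set where
    here : ∀ {u} → P u → Reach P u u
    step : ∀ {u w v} → P u → Edge u w → Reach P w v → Reach P u v

  ConnectedMinus : Subset n → Set
  ConnectedMinus X = ∀ u v → u ∉ X → v ∉ X → Reach (λ w → w ∉ X) u v

  KConnected : ℕ → Set
  KConnected k = (k < n) × (∀ (X : Subset n) → ∣ X ∣ < k → ConnectedMinus X)

  endpoints : List (Fin n × Fin n) → List (Fin n)
  endpoints = concatMap (λ { (a , b) → a ∷ b ∷ [] })

  IsMatching : List (Fin n × Fin n) → Set
  IsMatching M = All (λ { (a , b) → Edge a b }) M × Unique (endpoints M)

  VM : List (Fin n × Fin n) → Subset n
  VM M = tabulate (λ v → does (v ∈L? endpoints M))

  IsMaximal : List (Fin n × Fin n) → Set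
  IsMaximal M = IsMatching M ×
    (∀ u v → Edge u v → ¬ (u Mem.∈ endpoints M) → ¬ (v Mem.∈ endpoints M) → ⊥)

  IsMaximum : List (Fin n × Fin n) → Set
  IsMaximum M = IsMatching M × (∀ M' → IsMatching M' → length M' ≤ length M)

  Equimatchable : Set
  Equimatchable = ∀ M → IsMaximal M → IsMaximum M

  FactorCritical : Set
  FactorCritical = ∀ v → ∃ λ M → IsMatching M × ¬ (v Mem.∈ endpoints M)
                     × (∀ w → w ≢ v → w Mem.∈ endpoints M)

  Complete : Subset n → Set
  Complete X = ∀ u v → u ∈ X → v ∈ X → u ≢ v → Edge u v

module Submission where

-- Let M be a maximal matching of G[S - s]. The vertices of S it leaves uncovered
-- include s, and their number has the parity of k. If there were four, three of them
-- besides s would be pairwise non-adjacent. Covering the cliques C and D, with a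
-- neighbour of s in each (k-connectivity) as the spare vertex, leaves at most one
-- further uncovered vertex, a hub in D ∪ {s}; every maximal extension then adds
-- at most one edge, at the hub, and leaves two vertices uncovered, which
-- equimatchability and factor-criticality forbid. So one to three vertices of S
-- are uncovered, and if only one, dropping an edge of M uncovers three.

open import Defs
open import Data.Nat using (ℕ; suc; _+_; _*_; _≤_; _<_; _%_; z≤n; s≤s)
open import Data.Nat.Properties
  using (≤-refl; ≤-trans; ≤-reflexive; n≤1+n; m≤n⇒m≤1+n; +-suc; +-identityʳ; +-mono-≤; *-monoˡ-≤;
         +-cancelʳ-≤; +-cancelʳ-≡; module ≤-Reasoning)
open import Data.Nat.DivMod using ([m+kn]%n≡m%n)
open import Data.Bool using (true)
open import Data.Bool.Properties using () renaming (_≟_ to _≟ᵇ_)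
open import Data.Fin using (Fin)
open import Data.Fin.Properties using (_≟_; any?)
open import Data.Fin.Subset
  using (Subset; _∈_; _∉_; ∣_∣; _─_; _-_; _∪_; ⊤; ⁅_⁆; _⊆_; Nonempty; inside; outside)
  renaming (⊥ to ∅)
open import Data.Fin.Subset.Properties
  using (p─⊥≡p; p─q─r≡p─q∪r; p─q⊆p; ⊆-antisym; Empty-unique; ∈⊤; ∣⊤∣≡n; ∣⊥∣≡0; nonempty?;
         x∈p∧x∉q⇒x∈p─q; x∈p∧x≢y⇒x∈p-y; x∈p⇒∣p-x∣<∣p∣; p⊆q⇒∣p∣≤∣q∣; x∈p∪q⁺; x∈p∪q⁻;
         x∈⁅x⁆; x∈⁅y⁆⇒x≡y; x∉⁅y⁆⇒x≢y; ∣⁅x⁆∣≡1)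
  renaming (_∈?_ to _∈ˢ?_)
open import Data.Vec.Base using (_∷_; tabulate) renaming (here to at-head; there to in-tail)
open import Data.Vec.Properties using (lookup∘tabulate; lookup⇒[]=; []=⇒lookup)
open import Data.Product using (_×_; _,_; ∃; ∃₂; proj₁; proj₂)
open import Data.Sum using (_⊎_; inj₁; inj₂; [_,_]′)
open import Data.List using (List; []; _∷_; length; allFin; cartesianProduct)
open import Data.List.Relation.Unary.All using (All; []; _∷_)
open import Data.List.Relation.Unary.All.Properties.Core using (¬Any⇒All¬; All¬⇒¬Any)
open import Data.List.Relation.Unary.Any using (here; there)
open import Data.List.Relation.Unary.AllPairs using ([]; _∷_)
open import Data.List.Relation.Unary.Unique.Propositional using (Unique)
open import Data.List.Membership.Propositional using () renaming (_∈_ to _∈ₗ_)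
open import Data.List.Membership.Propositional.Properties using (∈-allFin; ∈-cartesianProduct⁺)
import Data.List.Membership.DecPropositional as DecMembership
open import Data.Empty using (⊥-elim)
open import Function using (_∘_; id)
open import Relation.Nullary using (¬_; Dec; yes; no; does)
open import Relation.Nullary.Decidable using (dec-true; _×-dec_; ¬?)
open import Relation.Unary using (Decidable)
open import Relation.Binary.PropositionalEquality
  using (_≡_; _≢_; refl; sym; trans; cong; subst; module ≡-Reasoning)

∣p∣≡1+∣p-x∣ : ∀ {n} {p : Subset n} {x} → x ∈ p → ∣ p ∣ ≡ suc ∣ p - x ∣
∣p∣≡1+∣p-x∣ {p = inside ∷ p}  at-head       = cong (suc ∘ ∣_∣) (sym (p─⊥≡p p))
∣p∣≡1+∣p-x∣ {p = inside ∷ p}  (in-tail x∈p) = cong suc (∣p∣≡1+∣p-x∣ x∈p)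
∣p∣≡1+∣p-x∣ {p = outside ∷ p} (in-tail x∈p) = ∣p∣≡1+∣p-x∣ x∈p

x∈p─q⇒x∉q : ∀ {n} {p q : Subset n} {x} → x ∈ p ─ q → x ∉ q
x∈p─q⇒x∉q {p = _ ∷ _} {q = _ ∷ _} (in-tail x∈p─q) (in-tail x∈q) = x∈p─q⇒x∉q x∈p─q x∈q

x∈p-y⁻ : ∀ {n} {p : Subset n} {x y} → x ∈ p - y → x ∈ p × x ≢ y
x∈p-y⁻ {p = p} {y = y} x∈p-y = p─q⊆p p ⁅ y ⁆ x∈p-y , x∉⁅y⁆⇒x≢y (x∈p─q⇒x∉q x∈p-y)

∣p∣≤1+∣p-x∣ : ∀ {n} (p : Subset n) x → ∣ p ∣ ≤ suc ∣ p - x ∣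
∣p∣≤1+∣p-x∣ p x with x ∈ˢ? p
... | yes x∈p = ≤-reflexive (∣p∣≡1+∣p-x∣ x∈p)
... | no x∉p  = m≤n⇒m≤1+n (p⊆q⇒∣p∣≤∣q∣ p⊆p-x)
  where
  p⊆p-x : p ⊆ p - x
  p⊆p-x y∈p = x∈p∧x≢y⇒x∈p-y y∈p λ { refl → x∉p y∈p }

module _ {n : ℕ} where
  open DecMembership (_≟_ {n}) using (_∈?_)

  -- VM G M is definitionally toSubset (endpoints G M).
  toSubset : List (Fin n) → Subset n
  toSubset L = tabulate (λ v → does (v ∈? L))

  ∈toSubset⁺ : ∀ {v L} → v ∈ₗ L → v ∈ toSubset L
  ∈toSubset⁺ {v} {L} v∈L = lookup⇒[]= v _ (trans (lookup∘tabulate _ v) (dec-true (v ∈? L) v∈L))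

  ∈toSubset⁻ : ∀ {v L} → v ∈ toSubset L → v ∈ₗ L
  ∈toSubset⁻ {v} {L} v∈ with v ∈? L | trans (sym (lookup∘tabulate _ v)) ([]=⇒lookup v∈)
  ... | yes v∈L | _ = v∈L
  ... | no _    | ()

  x∈p─L⁺ : ∀ {p : Subset n} {L x} → x ∈ p → ¬ x ∈ₗ L → x ∈ p ─ toSubset L
  x∈p─L⁺ x∈p x∉L = x∈p∧x∉q⇒x∈p─q x∈p (x∉L ∘ ∈toSubset⁻)

  x∈p─L⁻ : ∀ {p : Subset n} {L x} → x ∈ p ─ toSubset L → x ∈ p × ¬ x ∈ₗ L
  x∈p─L⁻ {p} {L} x∈ = p─q⊆p p (toSubset L) x∈ , x∈p─q⇒x∉q x∈ ∘ ∈toSubset⁺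

  toSubset-[] : toSubset [] ≡ ∅
  toSubset-[] = Empty-unique λ { (_ , v∈) → absurd (∈toSubset⁻ v∈) }
    where
    absurd : ∀ {v} → ¬ v ∈ₗ []
    absurd ()

  toSubset-∷ : ∀ x L → toSubset (x ∷ L) ≡ toSubset L ∪ ⁅ x ⁆
  toSubset-∷ x L = ⊆-antisym ⊆∪ ∪⊆
    where
    ⊆∪ : toSubset (x ∷ L) ⊆ toSubset L ∪ ⁅ x ⁆
    ⊆∪ y∈ with ∈toSubset⁻ {L = x ∷ L} y∈
    ... | here refl = x∈p∪q⁺ (inj₂ (x∈⁅x⁆ x))
    ... | there y∈L = x∈p∪q⁺ (inj₁ (∈toSubset⁺ y∈L))
    ∪⊆ : toSubset L ∪ ⁅ x ⁆ ⊆ toSubset (x ∷ L)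
    ∪⊆ y∈ with x∈p∪q⁻ (toSubset L) ⁅ x ⁆ y∈
    ... | inj₁ y∈L = ∈toSubset⁺ {L = x ∷ L} (there (∈toSubset⁻ y∈L))
    ... | inj₂ y∈x = ∈toSubset⁺ {L = x ∷ L} (here (x∈⁅y⁆⇒x≡y x y∈x))

  ∣p─L∣+∣L∣≡∣p∣ : ∀ (p : Subset n) {L} → Unique L → (∀ {v} → v ∈ₗ L → v ∈ p)
    → ∣ p ─ toSubset L ∣ + length L ≡ ∣ p ∣
  ∣p─L∣+∣L∣≡∣p∣ p {[]} _ _ = begin
    ∣ p ─ toSubset [] ∣ + 0  ≡⟨ +-identityʳ _ ⟩
    ∣ p ─ toSubset [] ∣      ≡⟨ cong (λ q → ∣ p ─ q ∣) toSubset-[] ⟩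
    ∣ p ─ ∅ ∣                ≡⟨ cong ∣_∣ (p─⊥≡p p) ⟩
    ∣ p ∣                    ∎
    where open ≡-Reasoning
  ∣p─L∣+∣L∣≡∣p∣ p {x ∷ L} (x∉L ∷ unique) L⊆p = begin
    ∣ p ─ toSubset (x ∷ L) ∣ + suc (length L)    ≡⟨ +-suc _ (length L) ⟩
    suc ∣ p ─ toSubset (x ∷ L) ∣ + length L      ≡⟨ cong (λ q → suc ∣ p ─ q ∣ + length L) (toSubset-∷ x L) ⟩
    suc ∣ p ─ (toSubset L ∪ ⁅ x ⁆) ∣ + length L  ≡⟨ cong (λ q → suc ∣ q ∣ + length L) (sym (p─q─r≡p─q∪r p _ _)) ⟩
    suc ∣ p ─ toSubset L - x ∣ + length L        ≡⟨ cong (_+ length L) (sym (∣p∣≡1+∣p-x∣ x∈p─L)) ⟩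
    ∣ p ─ toSubset L ∣ + length L                ≡⟨ ∣p─L∣+∣L∣≡∣p∣ p unique (L⊆p ∘ there) ⟩
    ∣ p ∣                                        ∎
    where
    open ≡-Reasoning
    x∈p─L : x ∈ p ─ toSubset L
    x∈p─L = x∈p─L⁺ (L⊆p (here refl)) (All¬⇒¬Any x∉L)

by-parity : ∀ {u k} → u ≡ 2 ⊎ u ≡ 3 → u % 2 ≡ k % 2
  → (k % 2 ≡ 0 → u ≡ 2) × (k % 2 ≡ 1 → u ≡ 3)
by-parity (inj₁ refl) same = (λ _ → refl) , λ odd → absurd (trans same odd)
  where
  absurd : ∀ {A : Set} → 0 ≡ 1 → A
  absurd ()
by-parity (inj₂ refl) same = (λ even → absurd (trans same even)) , λ _ → refl
  where
  absurd : ∀ {A : Set} → 1 ≡ 0 → A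
  absurd ()

module Matchings {n : ℕ} (G : Graph n) where
  open Graph G using (adj; irrefl) renaming (sym to adj-sym)
  open DecMembership (_≟_ {n}) using (_∈?_)

  Edge? : ∀ u v → Dec (Edge G u v)
  Edge? u v = adj u v ≟ᵇ true

  Edge-sym : ∀ {u v} → Edge G u v → Edge G v u
  Edge-sym {u} {v} u~v = trans (adj-sym v u) u~v

  Edge⇒≢ : ∀ {u v} → Edge G u v → u ≢ v
  Edge⇒≢ {u} u~u refl with trans (sym u~u) (irrefl u)
  ... | ()

  Reach-start : ∀ {P u v} → Reach G P u v → P u
  Reach-start (here Pu)     = Pu
  Reach-start (step Pu _ _) = Pu

  exit-edge : ∀ {P : Fin n → Set} {A : Subset n} {a b} → Reach G P a b → a ∈ A → b ∉ A
    → ∃₂ λ c y → c ∈ A × Edge G c y × y ∉ A × P y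
  exit-edge (here _) a∈A a∉A = ⊥-elim (a∉A a∈A)
  exit-edge {A = A} (step {w = w} _ a~w path) a∈A b∉A with w ∈ˢ? A
  ... | yes w∈A = exit-edge path w∈A b∉A
  ... | no w∉A  = _ , w , a∈A , a~w , w∉A , Reach-start path

  record Separation (S A B : Subset n) : Set where
    field
      cover : ∀ v → v ∈ S ⊎ v ∈ A ⊎ v ∈ B
      S∩A≡∅ : ∀ v → v ∈ S → v ∉ A
      S∩B≡∅ : ∀ v → v ∈ S → v ∉ B
      A∩B≡∅ : ∀ v → v ∈ A → v ∉ B
      A≁B   : ∀ u v → u ∈ A → v ∈ B → ¬ Edge G u v

  Separation-swap : ∀ {S A B} → Separation S A B → Separation S B A
  Separation-swap sep = record
    { cover = λ v → [ inj₁ , (inj₂ ∘ [ inj₂ , inj₁ ]′) ]′ (cover v)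
    ; S∩A≡∅ = S∩B≡∅
    ; S∩B≡∅ = S∩A≡∅
    ; A∩B≡∅ = λ v v∈B v∈A → A∩B≡∅ v v∈A v∈B
    ; A≁B   = λ u v u∈B v∈A u~v → A≁B v u v∈A u∈B (Edge-sym u~v)
    }
    where open Separation sep

  -- Removing S - s leaves G connected, so a path from A to B must leave A;
  -- it can only do so through s.
  neighbour-across-cut : ∀ {k S A B} → KConnected G k → ∣ S ∣ ≡ k → Separation S A B
    → Nonempty A → Nonempty B → ∀ {s} → s ∈ S → ∃ λ a → a ∈ A × Edge G s a
  neighbour-across-cut {S = S} {A} (_ , connected) ∣S∣≡k sep (a , a∈A) (b , b∈B) {s} s∈S =
    leave (exit-edge path a∈A λ b∈A → A∩B≡∅ b b∈A b∈B)
    where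
    open Separation sep
    ∉S⇒∉S-s : ∀ {v} → v ∉ S → v ∉ S - s
    ∉S⇒∉S-s v∉S = v∉S ∘ proj₁ ∘ x∈p-y⁻
    path : Reach G (_∉ S - s) a b
    path = connected (S - s) (subst (∣ S - s ∣ <_) ∣S∣≡k (x∈p⇒∣p-x∣<∣p∣ s∈S)) a b
             (∉S⇒∉S-s λ a∈S → S∩A≡∅ a a∈S a∈A) (∉S⇒∉S-s λ b∈S → S∩B≡∅ b b∈S b∈B)
    leave : (∃₂ λ c y → c ∈ A × Edge G c y × y ∉ A × y ∉ S - s) → ∃ λ a → a ∈ A × Edge G s a
    leave (c , y , c∈A , c~y , y∉A , y∉S-s) with cover y
    ... | inj₂ (inj₁ y∈A) = ⊥-elim (y∉A y∈A)
    ... | inj₂ (inj₂ y∈B) = ⊥-elim (A≁B c y c∈A y∈B c~y)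
    ... | inj₁ y∈S with y ≟ s
    ...   | yes refl = c , c∈A , Edge-sym c~y
    ...   | no y≢s   = ⊥-elim (y∉S-s (x∈p∧x≢y⇒x∈p-y y∈S y≢s))

  infix 4 _∈V_ _∉V_ _∈V?_

  _∈V_ : Fin n → List (Fin n × Fin n) → Set
  v ∈V M = v ∈ₗ endpoints G M

  _∉V_ : Fin n → List (Fin n × Fin n) → Set
  v ∉V M = ¬ v ∈V M

  _∈V?_ : ∀ v M → Dec (v ∈V M)
  v ∈V? M = v ∈? endpoints G M

  ∉V-∷⁺ : ∀ {a b M v} → v ≢ a → v ≢ b → v ∉V M → v ∉V ((a , b) ∷ M)
  ∉V-∷⁺ v≢a _   _   (here v≡a)          = v≢a v≡a
  ∉V-∷⁺ _   v≢b _   (there (here v≡b))  = v≢b v≡b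
  ∉V-∷⁺ _   _   v∉M (there (there v∈M)) = v∉M v∈M

  ∉V-∷⁻ : ∀ {a b M v} → v ∉V ((a , b) ∷ M) → v ≢ a × v ∉V M
  ∉V-∷⁻ v∉ = v∉ ∘ here , v∉ ∘ there ∘ there

  IsMatching-∷ : ∀ {M a b} → IsMatching G M → Edge G a b → a ∉V M → b ∉V M
    → IsMatching G ((a , b) ∷ M)
  IsMatching-∷ (edges , unique) a~b a∉ b∉ =
    a~b ∷ edges , (Edge⇒≢ a~b ∷ ¬Any⇒All¬ _ a∉) ∷ ¬Any⇒All¬ _ b∉ ∷ unique

  All-pairs : ∀ {P : Fin n → Set} M → (∀ {v} → v ∈V M → P v)
    → All (λ e → P (proj₁ e) × P (proj₂ e)) M
  All-pairs []      _    = []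
  All-pairs (_ ∷ M) M⊆P = (M⊆P (here refl) , M⊆P (there (here refl))) ∷ All-pairs M (M⊆P ∘ there ∘ there)

  length-endpoints : ∀ M → length (endpoints G M) ≡ length M * 2
  length-endpoints []      = refl
  length-endpoints (_ ∷ M) = cong (suc ∘ suc) (length-endpoints M)

  ∣S─VM∣+∣M∣*2≡∣S∣ : ∀ (S : Subset n) {M} → IsMatching G M → (∀ {v} → v ∈V M → v ∈ S)
    → ∣ S ─ VM G M ∣ + length M * 2 ≡ ∣ S ∣
  ∣S─VM∣+∣M∣*2≡∣S∣ S {M} (_ , unique) M⊆S =
    trans (cong (∣ S ─ VM G M ∣ +_) (sym (length-endpoints M))) (∣p─L∣+∣L∣≡∣p∣ S unique M⊆S)

  ∣S─VM∣%2≡∣S∣%2 : ∀ (S : Subset n) {M} → IsMatching G M → (∀ {v} → v ∈V M → v ∈ S)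
    → ∣ S ─ VM G M ∣ % 2 ≡ ∣ S ∣ % 2
  ∣S─VM∣%2≡∣S∣%2 S {M} M-matching M⊆S =
    trans (sym ([m+kn]%n≡m%n ∣ S ─ VM G M ∣ (length M) 2)) (cong (_% 2) (∣S─VM∣+∣M∣*2≡∣S∣ S M-matching M⊆S))

  ∣S─VM∣≡2+∣S─VM∷∣ : ∀ (S : Subset n) {e M} → IsMatching G (e ∷ M) → (∀ {v} → v ∈V e ∷ M → v ∈ S)
    → ∣ S ─ VM G M ∣ ≡ 2 + ∣ S ─ VM G (e ∷ M) ∣
  ∣S─VM∣≡2+∣S─VM∷∣ S {e} {M} e∷M-matching@(_ ∷ edges , _ ∷ _ ∷ unique) e∷M⊆S =
    +-cancelʳ-≡ (length M * 2) _ _ (begin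
      ∣ S ─ VM G M ∣ + length M * 2                    ≡⟨ ∣S─VM∣+∣M∣*2≡∣S∣ S (edges , unique) (e∷M⊆S ∘ there ∘ there) ⟩
      ∣ S ∣                                            ≡⟨ sym (∣S─VM∣+∣M∣*2≡∣S∣ S e∷M-matching e∷M⊆S) ⟩
      ∣ S ─ VM G (e ∷ M) ∣ + suc (suc (length M * 2))  ≡⟨ +-suc ∣ S ─ VM G (e ∷ M) ∣ _ ⟩
      suc (∣ S ─ VM G (e ∷ M) ∣ + suc (length M * 2))  ≡⟨ cong suc (+-suc ∣ S ─ VM G (e ∷ M) ∣ _) ⟩
      2 + ∣ S ─ VM G (e ∷ M) ∣ + length M * 2          ∎)
    where open ≡-Reasoning

  drop-edge : ∀ (S : Subset n) {P : Fin n → Set} {M} → (∀ {v} → P v → v ∈ S) → 3 ≤ ∣ S ∣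
    → IsMatching G M → (∀ {v} → v ∈V M → P v) → ∣ S ─ VM G M ∣ ≡ 1
    → ∃ λ M′ → IsMatching G M′ × (∀ {v} → v ∈V M′ → P v) × ∣ S ─ VM G M′ ∣ ≡ 3
  drop-edge S {M = []} _ 3≤∣S∣ []-matching _ u≡1 = ⊥-elim (absurd (subst (3 ≤_) ∣S∣≡1 3≤∣S∣))
    where
    ∣S∣≡1 : ∣ S ∣ ≡ 1
    ∣S∣≡1 = trans (sym (∣S─VM∣+∣M∣*2≡∣S∣ S []-matching λ ())) (trans (+-identityʳ _) u≡1)
    absurd : ¬ 3 ≤ 1
    absurd (s≤s ())
  drop-edge S {M = e ∷ M} P⊆S _ e∷M-matching@(_ ∷ edges , _ ∷ _ ∷ unique) e∷M⊆P u≡1 =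
    M , (edges , unique) , e∷M⊆P ∘ there ∘ there ,
    trans (∣S─VM∣≡2+∣S─VM∷∣ S e∷M-matching (P⊆S ∘ e∷M⊆P)) (cong (2 +_) u≡1)

  two-or-three-uncovered : ∀ (S : Subset n) {P : Fin n → Set} {M} → (∀ {v} → P v → v ∈ S) → 3 ≤ ∣ S ∣
    → IsMatching G M → (∀ {v} → v ∈V M → P v) → 1 ≤ ∣ S ─ VM G M ∣ → ∣ S ─ VM G M ∣ ≤ 3
    → ∃ λ M′ → IsMatching G M′ × (∀ {v} → v ∈V M′ → P v) × (∣ S ─ VM G M′ ∣ ≡ 2 ⊎ ∣ S ─ VM G M′ ∣ ≡ 3)
  two-or-three-uncovered S {M = M} P⊆S 3≤∣S∣ M-matching M⊆P 1≤u u≤3 with ∣ S ─ VM G M ∣ in u≡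
  ... | 1 = let M′ , M′-matching , M′⊆P , u′≡3 = drop-edge S P⊆S 3≤∣S∣ M-matching M⊆P u≡
            in M′ , M′-matching , M′⊆P , inj₂ u′≡3
  ... | 2 = M , M-matching , M⊆P , inj₁ u≡
  ... | 3 = M , M-matching , M⊆P , inj₂ u≡
  ... | 0 with () ← 1≤u
  ... | suc (suc (suc (suc _))) with s≤s (s≤s (s≤s ())) ← u≤3

  -- Factor-criticality gives a matching leaving one vertex uncovered, and
  -- equimatchability makes N at least as large.
  ∣uncovered∣≤1 : Equimatchable G → FactorCritical G → ∀ {N} → IsMaximal G N
    → (X : Subset n) → (∀ {x} → x ∈ X → x ∉V N) → ∣ X ∣ ≤ 1
  ∣uncovered∣≤1 equimatchable critical {N} N-maximal X X-uncovered with nonempty? X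
  ... | no X≡∅ = ≤-trans (≤-reflexive (trans (cong ∣_∣ (Empty-unique X≡∅)) (∣⊥∣≡0 n))) z≤n
  ... | yes (a , _) with critical a
  ... | P , P-matching , _ , P-covers =
    +-cancelʳ-≤ (length N * 2) ∣ X ∣ 1 (begin
      ∣ X ∣ + length N * 2           ≤⟨ +-mono-≤ (p⊆q⇒∣p∣≤∣q∣ (x∈p─L⁺ ∈⊤ ∘ X-uncovered)) ≤-refl ⟩
      ∣ ⊤ ─ VM G N ∣ + length N * 2  ≡⟨ count (proj₁ N-maximal) ⟩
      n                              ≡⟨ sym (count P-matching) ⟩
      ∣ ⊤ ─ VM G P ∣ + length P * 2  ≤⟨ +-mono-≤ ∣⊤─VM-P∣≤1 (*-monoˡ-≤ 2 (proj₂ (equimatchable N N-maximal) P P-matching)) ⟩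
      1 + length N * 2               ∎)
    where
    open ≤-Reasoning
    count : ∀ {M} → IsMatching G M → ∣ ⊤ ─ VM G M ∣ + length M * 2 ≡ n
    count M-matching = trans (∣S─VM∣+∣M∣*2≡∣S∣ ⊤ M-matching λ _ → ∈⊤) (∣⊤∣≡n n)
    ⊤─VM-P⊆⁅a⁆ : ⊤ ─ VM G P ⊆ ⁅ a ⁆
    ⊤─VM-P⊆⁅a⁆ {y} y∈ with y ≟ a
    ... | yes refl = x∈⁅x⁆ a
    ... | no y≢a   = ⊥-elim (proj₂ (x∈p─L⁻ y∈) (P-covers y y≢a))
    ∣⊤─VM-P∣≤1 : ∣ ⊤ ─ VM G P ∣ ≤ 1
    ∣⊤─VM-P∣≤1 = ≤-trans (p⊆q⇒∣p∣≤∣q∣ ⊤─VM-P⊆⁅a⁆) (≤-reflexive (∣⁅x⁆∣≡1 a))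

  maximal⊎uncovered-edge : ∀ {N} → IsMatching G N
    → IsMaximal G N ⊎ ∃₂ λ a b → Edge G a b × a ∉V N × b ∉V N
  maximal⊎uncovered-edge {N} N-matching
    with any? (λ a → any? (λ b → Edge? a b ×-dec ¬? (a ∈V? N) ×-dec ¬? (b ∈V? N)))
  ... | yes (a , b , uncovered-edge) = inj₂ (a , b , uncovered-edge)
  ... | no none = inj₁ (N-matching , λ a b a~b a∉ b∉ → none (a , b , a~b , a∉ , b∉))

  -- At most one edge can still be added to N, and it covers at most one vertex of I.
  ∣uncovered-off-hub∣≤2 : Equimatchable G → FactorCritical G → ∀ {N} → IsMatching G N
    → (Hub : Fin n → Set) → (∀ {x y} → Hub x → Hub y → x ≡ y)
    → (∀ {a b} → a ∉V N → b ∉V N → Edge G a b → Hub a ⊎ Hub b)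
    → (I : Subset n) → (∀ {x} → x ∈ I → x ∉V N × ¬ Hub x) → ∣ I ∣ ≤ 2
  ∣uncovered-off-hub∣≤2 equimatchable critical {N} N-matching Hub hub-unique hub-meets I I-off-hub =
    [ (λ N-maximal → ≤-trans (∣uncovered∣≤1 equimatchable critical N-maximal I (proj₁ ∘ I-off-hub)) (n≤1+n 1))
    , extend-by-edge
    ]′ (maximal⊎uncovered-edge N-matching)
    where
    through-hub : ∀ {h w} → Hub h → Edge G h w → h ∉V N → w ∉V N → ∣ I ∣ ≤ 2
    through-hub {h} {w} hub-h h~w h∉ w∉ =
      ≤-trans (∣p∣≤1+∣p-x∣ I w) (s≤s (∣uncovered∣≤1 equimatchable critical N′-maximal (I - w) I-w-uncovered))
      where
      N′-maximal : IsMaximal G ((h , w) ∷ N)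
      N′-maximal = IsMatching-∷ N-matching h~w h∉ w∉ , λ x y x~y x∉ y∉ →
        let x≢h , x∉N = ∉V-∷⁻ {M = N} x∉
            y≢h , y∉N = ∉V-∷⁻ {M = N} y∉
        in [ x≢h ∘ (λ hub-x → hub-unique hub-x hub-h) , y≢h ∘ (λ hub-y → hub-unique hub-y hub-h) ]′
             (hub-meets x∉N y∉N x~y)
      I-w-uncovered : ∀ {x} → x ∈ I - w → x ∉V (h , w) ∷ N
      I-w-uncovered x∈I-w =
        let x∈I , x≢w = x∈p-y⁻ x∈I-w
            x∉N , ¬hub-x = I-off-hub x∈I
        in ∉V-∷⁺ {M = N} (λ { refl → ¬hub-x hub-h }) x≢w x∉N
    extend-by-edge : (∃₂ λ a b → Edge G a b × a ∉V N × b ∉V N) → ∣ I ∣ ≤ 2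
    extend-by-edge (a , b , a~b , a∉ , b∉) =
      [ (λ hub-a → through-hub hub-a a~b a∉ b∉) , (λ hub-b → through-hub hub-b (Edge-sym a~b) b∉ a∉) ]′
        (hub-meets a∉ b∉ a~b)

  allPairs : List (Fin n × Fin n)
  allPairs = cartesianProduct (allFin n) (allFin n)

  ∈-allPairs : ∀ u v → (u , v) ∈ₗ allPairs
  ∈-allPairs u v = ∈-cartesianProduct⁺ (∈-allFin u) (∈-allFin v)

  record Extension (P : Fin n → Set) (candidates N : List (Fin n × Fin n)) : Set where
    field
      matching   : List (Fin n × Fin n)
      isMatching : IsMatching G matching
      keeps      : ∀ {v} → v ∈V N → v ∈V matching
      new-in     : ∀ {v} → v ∈V matching → v ∈V N ⊎ P v
      saturates  : ∀ {u v} → (u , v) ∈ₗ candidates → P u → P v → Edge G u v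
                   → u ∈V matching ⊎ v ∈V matching

  greedy : ∀ {P} → Decidable P → ∀ candidates {N} → IsMatching G N → Extension P candidates N
  greedy P? [] {N} N-matching = record
    { matching = N ; isMatching = N-matching ; keeps = id ; new-in = inj₁ ; saturates = λ () }
  greedy {P} P? ((u , v) ∷ candidates) {N} N-matching
    with P? u ×-dec P? v ×-dec Edge? u v ×-dec ¬? (u ∈V? N) ×-dec ¬? (v ∈V? N)
  ... | yes (Pu , Pv , u~v , u∉ , v∉) = record
    { matching   = R.matching
    ; isMatching = R.isMatching
    ; keeps      = R.keeps ∘ there ∘ there
    ; new-in     = λ x∈ → [ (λ { (here refl) → inj₂ Pu
                               ; (there (here refl)) → inj₂ Pv
                               ; (there (there x∈N)) → inj₁ x∈N })
                          , inj₂ ]′ (R.new-in x∈)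
    ; saturates  = λ { (here refl) _ _ _ → inj₁ (R.keeps (here refl)) ; (there c) → R.saturates c }
    }
    where module R = Extension (greedy P? candidates (IsMatching-∷ N-matching u~v u∉ v∉))
  ... | no ¬addable = record
    { matching   = R.matching
    ; isMatching = R.isMatching
    ; keeps      = R.keeps
    ; new-in     = R.new-in
    ; saturates  = λ { (here refl) → blocked ; (there c) → R.saturates c }
    }
    where
    module R = Extension (greedy P? candidates N-matching)
    blocked : P u → P v → Edge G u v → u ∈V R.matching ⊎ v ∈V R.matching
    blocked Pu Pv u~v with u ∈V? N | v ∈V? N
    ... | yes u∈ | _      = inj₁ (R.keeps u∈)
    ... | no _   | yes v∈ = inj₂ (R.keeps v∈)
    ... | no u∉  | no v∉  = ⊥-elim (¬addable (Pu , Pv , u~v , u∉ , v∉))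

  record CliqueCover (K : Subset n) (k₀ s : Fin n) (N : List (Fin n × Fin n)) : Set where
    field
      matching     : List (Fin n × Fin n)
      isMatching   : IsMatching G matching
      keeps        : ∀ {v} → v ∈V N → v ∈V matching
      new-in       : ∀ {v} → v ∈V matching → v ∈V N ⊎ v ∈ K ⊎ v ≡ s
      uncovered-in : ∀ {x} → x ∈ K → x ∉V matching → x ≡ k₀ × s ∈V N

  -- Match K - k₀ greedily; then give k₀ the leftover vertex of K if there is one,
  -- and otherwise s if it is still free.
  cover-clique : ∀ {K k₀ s N} → Complete G K → k₀ ∈ K → s ∉ K → Edge G s k₀
    → IsMatching G N → (∀ {x} → x ∈ K → x ∉V N) → CliqueCover K k₀ s N
  cover-clique {K} {k₀} {s} {N} K-complete k₀∈K s∉K s~k₀ N-matching K-free =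
    by-leftover (any? λ x → x ∈ˢ? K ×-dec ¬? (x ≟ k₀) ×-dec ¬? (x ∈V? R.matching))
    where
    module R = Extension (greedy (λ x → x ∈ˢ? K ×-dec ¬? (x ≟ k₀)) allPairs N-matching)

    k₀∉R : k₀ ∉V R.matching
    k₀∉R k₀∈ = [ K-free k₀∈K , (λ (_ , k₀≢k₀) → k₀≢k₀ refl) ]′ (R.new-in k₀∈)

    close : ∀ {w} → Edge G w k₀ → w ∉V R.matching → w ∈ K ⊎ w ≡ s
      → (∀ {y} → y ∈ K → y ≢ k₀ → y ≢ w → y ∈V R.matching) → CliqueCover K k₀ s N
    close {w} w~k₀ w∉ w∈K⊎w≡s others-covered = record
      { matching     = (w , k₀) ∷ R.matching
      ; isMatching   = IsMatching-∷ R.isMatching w~k₀ w∉ k₀∉R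
      ; keeps        = there ∘ there ∘ R.keeps
      ; new-in       = λ { (here refl) → inj₂ w∈K⊎w≡s
                         ; (there (here refl)) → inj₂ (inj₁ k₀∈K)
                         ; (there (there v∈)) → [ inj₁ , (λ (v∈K , _) → inj₂ (inj₁ v∈K)) ]′ (R.new-in v∈) }
      ; uncovered-in = λ y∈K y∉ → ⊥-elim (y∉ (covered y∈K))
      }
      where
      covered : ∀ {y} → y ∈ K → y ∈V (w , k₀) ∷ R.matching
      covered {y} y∈K with y ≟ k₀ | y ≟ w
      ... | yes refl | _        = there (here refl)
      ... | no _     | yes refl = here refl
      ... | no y≢k₀  | no y≢w   = there (there (others-covered y∈K y≢k₀ y≢w))

    by-leftover : Dec (∃ λ x → x ∈ K × x ≢ k₀ × x ∉V R.matching) → CliqueCover K k₀ s N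
    by-leftover (yes (x , x∈K , x≢k₀ , x∉)) =
      close (K-complete x k₀ x∈K k₀∈K x≢k₀) x∉ (inj₁ x∈K) λ {y} y∈K y≢k₀ y≢x →
        [ id , ⊥-elim ∘ x∉ ]′
          (R.saturates (∈-allPairs y x) (y∈K , y≢k₀) (x∈K , x≢k₀) (K-complete y x y∈K x∈K y≢x))
    by-leftover (no no-leftover) with s ∈V? R.matching
    ... | no s∉  = close s~k₀ s∉ (inj₂ refl) λ y∈K y≢k₀ _ → K-k₀-covered y∈K y≢k₀
      where
      K-k₀-covered : ∀ {y} → y ∈ K → y ≢ k₀ → y ∈V R.matching
      K-k₀-covered {y} y∈K y≢k₀ with y ∈V? R.matching
      ... | yes y∈ = y∈
      ... | no y∉  = ⊥-elim (no-leftover (y , y∈K , y≢k₀ , y∉))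
    ... | yes s∈ = record
      { matching     = R.matching
      ; isMatching   = R.isMatching
      ; keeps        = R.keeps
      ; new-in       = λ v∈ → [ inj₁ , (λ (v∈K , _) → inj₂ (inj₁ v∈K)) ]′ (R.new-in v∈)
      ; uncovered-in = λ y∈K y∉ → only-k₀ y∈K y∉ , [ id , (λ (s∈K , _) → ⊥-elim (s∉K s∈K)) ]′ (R.new-in s∈)
      }
      where
      only-k₀ : ∀ {y} → y ∈ K → y ∉V R.matching → y ≡ k₀
      only-k₀ {y} y∈K y∉ with y ≟ k₀
      ... | yes y≡k₀ = y≡k₀
      ... | no y≢k₀  = ⊥-elim (no-leftover (y , y∈K , y≢k₀ , y∉))

  -- Extend M to cover the cliques C and then D, with s as spare partner: what stays
  -- uncovered is the part of S - s missed by M plus at most one hub in D ∪ {s}.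
  ∣S─VM-s∣≤2 : Equimatchable G → FactorCritical G → ∀ {S C D} → Separation S C D
    → Complete G C → Complete G D
    → ∀ {s} → s ∈ S → (∃ λ c → c ∈ C × Edge G s c) → (∃ λ d → d ∈ D × Edge G s d)
    → ∀ {M} → IsMatching G M → (∀ {v} → v ∈V M → v ∈ S × v ≢ s)
    → (∀ {u v} → u ∈ S × u ≢ s → v ∈ S × v ≢ s → Edge G u v → u ∈V M ⊎ v ∈V M)
    → ∣ S ─ VM G M - s ∣ ≤ 2
  ∣S─VM-s∣≤2 equimatchable critical {S} {D = D} sep C-complete D-complete
    {s} s∈S (_ , c₀∈C , s~c₀) (_ , d₀∈D , s~d₀) {M} M-matching M⊆S-s M-saturates =
    ∣uncovered-off-hub∣≤2 equimatchable critical ND.isMatching Hub hub-unique hub-meets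
      (S ─ VM G M - s) I-off-hub
    where
    open Separation sep
    module NC = CliqueCover (cover-clique C-complete c₀∈C (S∩A≡∅ s s∈S) s~c₀ M-matching
                  λ {x} x∈C x∈M → S∩A≡∅ x (proj₁ (M⊆S-s x∈M)) x∈C)

    D-free : ∀ {x} → x ∈ D → x ∉V NC.matching
    D-free {x} x∈D x∈NC with NC.new-in x∈NC
    ... | inj₁ x∈M         = S∩B≡∅ x (proj₁ (M⊆S-s x∈M)) x∈D
    ... | inj₂ (inj₁ x∈C)  = A∩B≡∅ x x∈C x∈D
    ... | inj₂ (inj₂ refl) = S∩B≡∅ x s∈S x∈D

    module ND = CliqueCover (cover-clique D-complete d₀∈D (S∩B≡∅ s s∈S) s~d₀ NC.isMatching D-free)

    Hub : Fin n → Set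
    Hub x = (x ∈ D ⊎ x ≡ s) × x ∉V ND.matching

    hub-unique : ∀ {x y} → Hub x → Hub y → x ≡ y
    hub-unique (inj₁ x∈D , x∉) (inj₁ y∈D , y∉) =
      trans (proj₁ (ND.uncovered-in x∈D x∉)) (sym (proj₁ (ND.uncovered-in y∈D y∉)))
    hub-unique (inj₁ x∈D , x∉) (inj₂ refl , s∉) = ⊥-elim (s∉ (ND.keeps (proj₂ (ND.uncovered-in x∈D x∉))))
    hub-unique (inj₂ refl , s∉) (inj₁ y∈D , y∉) = ⊥-elim (s∉ (ND.keeps (proj₂ (ND.uncovered-in y∈D y∉))))
    hub-unique (inj₂ refl , _)  (inj₂ refl , _) = refl

    uncovered-hub-or-in-S-s : ∀ {x} → x ∉V ND.matching → Hub x ⊎ (x ∈ S × x ≢ s) × x ∉V M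
    uncovered-hub-or-in-S-s {x} x∉ with cover x
    ... | inj₂ (inj₁ x∈C) = ⊥-elim (proj₂ (M⊆S-s (proj₂ (NC.uncovered-in x∈C (x∉ ∘ ND.keeps)))) refl)
    ... | inj₂ (inj₂ x∈D) = inj₁ (inj₁ x∈D , x∉)
    ... | inj₁ x∈S with x ≟ s
    ...   | yes refl = inj₁ (inj₂ refl , x∉)
    ...   | no x≢s   = inj₂ ((x∈S , x≢s) , x∉ ∘ ND.keeps ∘ NC.keeps)

    hub-meets : ∀ {a b} → a ∉V ND.matching → b ∉V ND.matching → Edge G a b → Hub a ⊎ Hub b
    hub-meets a∉ b∉ a~b with uncovered-hub-or-in-S-s a∉ | uncovered-hub-or-in-S-s b∉
    ... | inj₁ hub-a | _          = inj₁ hub-a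
    ... | inj₂ _     | inj₁ hub-b = inj₂ hub-b
    ... | inj₂ (a∈S-s , a∉M) | inj₂ (b∈S-s , b∉M) = ⊥-elim ([ a∉M , b∉M ]′ (M-saturates a∈S-s b∈S-s a~b))

    I-off-hub : ∀ {x} → x ∈ S ─ VM G M - s → x ∉V ND.matching × ¬ Hub x
    I-off-hub {x} x∈I = x∉ND , λ { (inj₁ x∈D , _) → S∩B≡∅ x x∈S x∈D ; (inj₂ x≡s , _) → x≢s x≡s }
      where
      x∈S─M : x ∈ S ─ VM G M
      x∈S─M = proj₁ (x∈p-y⁻ x∈I)
      x≢s : x ≢ s
      x≢s = proj₂ (x∈p-y⁻ x∈I)
      x∈S : x ∈ S
      x∈S = proj₁ (x∈p─L⁻ {L = endpoints G M} x∈S─M)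
      x∉ND : x ∉V ND.matching
      x∉ND x∈ND with ND.new-in x∈ND
      ... | inj₂ (inj₁ x∈D) = S∩B≡∅ x x∈S x∈D
      ... | inj₂ (inj₂ x≡s) = x≢s x≡s
      ... | inj₁ x∈NC with NC.new-in x∈NC
      ...   | inj₁ x∈M        = proj₂ (x∈p─L⁻ x∈S─M) x∈M
      ...   | inj₂ (inj₁ x∈C) = S∩A≡∅ x x∈S x∈C
      ...   | inj₂ (inj₂ x≡s) = x≢s x≡s

lemma15 : (k n : ℕ) → 3 ≤ k → (G : Graph n)
    → KConnected G k → Equimatchable G → FactorCritical G
    → (S C D : Subset n) → ∣ S ∣ ≡ k
    → (∀ v → v ∈ S ⊎ (v ∈ C ⊎ v ∈ D))
    → (∀ v → v ∈ S → v ∉ C) → (∀ v → v ∈ S → v ∉ D) → (∀ v → v ∈ C → v ∉ D)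
    → Nonempty C → Nonempty D
    → (∀ u v → u ∈ C → v ∈ D → ¬ Edge G u v)
    → Complete G C → Complete G D
    → ∀ s → s ∈ S
    → ∃ λ (M : List (Fin n × Fin n)) → IsMatching G M
        × All (λ e → (proj₁ e ∈ S × proj₁ e ≢ s) × (proj₂ e ∈ S × proj₂ e ≢ s)) M
        × (k % 2 ≡ 0 → ∣ S ─ VM G M ∣ ≡ 2)
        × (k % 2 ≡ 1 → ∣ S ─ VM G M ∣ ≡ 3)
lemma15 _ _ 3≤∣S∣ G connected equimatchable critical S C D refl cover S∩C S∩D C∩D C≠∅ D≠∅ C≁D
        C-complete D-complete s s∈S =
  let M′ , M′-matching , M′⊆S-s , two-or-three =
        two-or-three-uncovered S proj₁ 3≤∣S∣ M.isMatching M⊆S-s 1≤∣S─VM∣ ∣S─VM∣≤3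
  in M′ , M′-matching , All-pairs M′ M′⊆S-s ,
     by-parity {k = ∣ S ∣} two-or-three (∣S─VM∣%2≡∣S∣%2 S M′-matching (proj₁ ∘ M′⊆S-s))
  where
  open Matchings G
  sep : Separation S C D
  sep = record { cover = cover ; S∩A≡∅ = S∩C ; S∩B≡∅ = S∩D ; A∩B≡∅ = C∩D ; A≁B = C≁D }
  module M = Extension (greedy (λ v → v ∈ˢ? S ×-dec ¬? (v ≟ s)) allPairs ([] , []))
  M⊆S-s : ∀ {v} → v ∈V M.matching → v ∈ S × v ≢ s
  M⊆S-s v∈ = [ (λ ()) , id ]′ (M.new-in v∈)
  s∈S─VM : s ∈ S ─ VM G M.matching
  s∈S─VM = x∈p─L⁺ s∈S λ s∈ → proj₂ (M⊆S-s s∈) refl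
  1≤∣S─VM∣ : 1 ≤ ∣ S ─ VM G M.matching ∣
  1≤∣S─VM∣ = ≤-trans (s≤s z≤n) (≤-reflexive (sym (∣p∣≡1+∣p-x∣ s∈S─VM)))
  ∣S─VM∣≤3 : ∣ S ─ VM G M.matching ∣ ≤ 3
  ∣S─VM∣≤3 = ≤-trans (≤-reflexive (∣p∣≡1+∣p-x∣ s∈S─VM)) (s≤s
    (∣S─VM-s∣≤2 equimatchable critical sep C-complete D-complete s∈S
      (neighbour-across-cut connected refl sep C≠∅ D≠∅ s∈S)
      (neighbour-across-cut connected refl (Separation-swap sep) D≠∅ C≠∅ s∈S)
      M.isMatching M⊆S-s λ {u} {v} → M.saturates (∈-allPairs u v)))
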